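{- Let $L$ be a finite lattice with $|L| \geq 3$, let $C$ be a finite chain disjoint from $L$, let $a<b$ in $L$ with $b$ not covering $a$, and let $L' = L ]_{a}^{b} C$. If $\operatorname{Dim}(L) = m$ then $m \leq \operatorname{Dim}(L') \leq m+1$.
   Context: Adjunct sum: for disjoint lattices $L_1,L_2$ and $a<b$ in $L_1$ with $a \not\prec b$, $L_1 ]^b_a L_2$ is the set $L_1 \cup L_2$ with $x \leq y$ iff either $x,y\in L_1$ and $x\leq y$ in $L_1$; or $x,y\in L_2$ and $x\leq y$ in $L_2$; or $x\in L_1$, $y\in L_2$ and $x \leq a$ in $L_1$; or $x \in L_2$, $y \in L_1$ and $b \leq y$ in $L_1$. The dimension $\operatorname{Dim}(P)$ of a finite poset $P$ is the least number of linear extensions of its order whose intersection is exactly its order. -}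

module Defs where

open import Level using (0ℓ)
open import Data.Nat using (ℕ; _<_)
open import Data.Fin using (Fin)
open import Data.Sum using (_⊎_; inj₁; inj₂)
open import Data.Product using (Σ; _×_; ∃)
open import Data.Empty using (⊥)
open import Relation.Nullary using (¬_)
open import Relation.Binary.PropositionalEquality using (_≡_)
open import Relation.Binary.Structures using (IsPartialOrder; IsTotalOrder)

Rel : Set → Set₁
Rel X = X → X → Set

Strict : {X : Set} → Rel X → Rel X
Strict _≤_ x y = (x ≤ y) × ¬ (x ≡ y)

Covers : {X : Set} → Rel X → X → X → Set
Covers _≤_ a b = Strict _≤_ a b × ¬ (∃ λ c → Strict _≤_ a c × Strict _≤_ c b)

record IsFinLattice {n : ℕ} (_≤_ : Rel (Fin n)) : Set where
  field
    isPartialOrder : IsPartialOrder _≡_ _≤_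
    join : ∀ x y → ∃ λ s → (x ≤ s) × (y ≤ s) × (∀ z → x ≤ z → y ≤ z → s ≤ z)
    meet : ∀ x y → ∃ λ i → (i ≤ x) × (i ≤ y) × (∀ z → z ≤ x → z ≤ y → z ≤ i)

AdjunctSum : {n k : ℕ} → Rel (Fin n) → Rel (Fin k) → Fin n → Fin n → Rel (Fin n ⊎ Fin k)
AdjunctSum _≤₁_ _≤₂_ a b (inj₁ x) (inj₁ y) = x ≤₁ y
AdjunctSum _≤₁_ _≤₂_ a b (inj₂ x) (inj₂ y) = x ≤₂ y
AdjunctSum _≤₁_ _≤₂_ a b (inj₁ x) (inj₂ y) = x ≤₁ a
AdjunctSum _≤₁_ _≤₂_ a b (inj₂ x) (inj₁ y) = b ≤₁ y

Realizer : {X : Set} → Rel X → ℕ → Set₁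
Realizer {X} R d =
  Σ (Fin d → Rel X) λ Ls →
    (∀ i → IsTotalOrder _≡_ (Ls i)) ×
    (∀ i x y → R x y → Ls i x y) ×
    (∀ x y → (∀ i → Ls i x y) → R x y)

HasDim : {X : Set} → Rel X → ℕ → Set₁
HasDim R m = Realizer R m × (∀ d → d < m → ¬ Realizer R d)

-- A realizer of L ]ᵇₐ C restricts to one of L, so Dim(L) ≤ Dim(L ]ᵇₐ C). Conversely,
-- let L₁, …, Lₘ realize L. Inserting the chain C directly above a in every Lᵢ, plus
-- one extension listing the elements not above b, then C, then the up-set of b,
-- gives m + 1 linear extensions realizing L ]ᵇₐ C: the Lᵢ separate the pairs inside L
-- and the pairs x ∈ L, c ∈ C with x ≰ a, while the extra extension puts c above
-- every y ≱ b. Choosing the least of m, m + 1 constructively requires deciding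
-- whether a realizer of size m exists, a finite search on a finite set.
module Submission where

open import Defs
open import Data.Nat using (ℕ; _≤_; _+_; suc)
open import Data.Fin using (Fin)
open import Data.Sum using (_⊎_)
open import Data.Product using (∃; _×_)
open import Relation.Nullary using (¬_)
open import Relation.Binary.PropositionalEquality using (_≡_)
open import Relation.Binary.Structures using (IsTotalOrder)

open import Level using (0ℓ)
open import Data.Bool using (Bool; true; false; T)
open import Data.Bool.Properties using (T?)
open import Data.Fin using (zero; suc)
open import Data.Fin.Properties using (all?; +↔⊎) renaming (_≟_ to _≟ᶠ_)
open import Data.Nat using (zero; _<_)
open import Data.Nat.Properties using (≤-refl; ≤-reflexive; n≤1+n; m≤m+n; +-comm; m<1+n⇒m<n∨m≡n)
open import Data.Product using (_,_; proj₁; proj₂)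
open import Data.Sum using (inj₁; inj₂; [_,_]′)
open import Data.Sum.Properties using (inj₁-injective)
open import Data.Sum.Relation.Binary.LeftOrder using (_⊎-<_; ₁∼₂; ₁∼₁; ₂∼₂; ⊎-<-isTotalOrder)
open import Data.Sum.Relation.Binary.Pointwise using (Pointwise-≡⇒≡)
open import Data.Vec using (Vec; []; _∷_; lookup; tabulate)
open import Data.Vec.Properties using (lookup∘tabulate)
open import Function using (_∘_; id; _on_; _↔_; Inverse; Injection)
open import Function.Definitions using (Injective)
open import Function.Properties.Inverse using (↔⇒↣; ↔-sym)
open import Relation.Binary.Consequences using (total∧dec⇒dec)
open import Relation.Binary.Core using (_⇒_)
open import Relation.Binary.Definitions using (Decidable; DecidableEquality; Total)
open import Relation.Binary.Morphism.Structures using (IsOrderMonomorphism)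
open import Relation.Binary.PropositionalEquality
  using (refl; sym; trans; cong; subst₂; isEquivalence; module ≡-Reasoning)
open import Relation.Binary.Structures using (IsPartialOrder)
import Relation.Binary.Construct.On as On
open import Relation.Nullary using (Dec; yes; no; contradiction)
open import Relation.Nullary.Decidable
  using (⌊_⌋; map′; _×-dec_; _⊎-dec_; _→-dec_; ¬?; decidable-stable; fromWitness; toWitness)
import Relation.Unary as U

private
  variable
    A B : Set
    d m N : ℕ

≡-isTotalOrder : {_≈_ _≤_ _⊑_ : Rel A} → _≈_ ⇒ _≡_ → _≤_ ⇒ _⊑_ → _⊑_ ⇒ _≤_ →
                 IsTotalOrder _≈_ _≤_ → IsTotalOrder _≡_ _⊑_
≡-isTotalOrder ≈⇒≡ ≤⇒⊑ ⊑⇒≤ ≤-total = record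
  { isPartialOrder = record
    { isPreorder = record
      { isEquivalence = isEquivalence
      ; reflexive     = λ { refl → ≤⇒⊑ O.refl }
      ; trans         = λ p q → ≤⇒⊑ (O.trans (⊑⇒≤ p) (⊑⇒≤ q))
      }
    ; antisym = λ p q → ≈⇒≡ (O.antisym (⊑⇒≤ p) (⊑⇒≤ q))
    }
  ; total = λ x y → Data.Sum.map ≤⇒⊑ ≤⇒⊑ (O.total x y)
  }
  where module O = IsTotalOrder ≤-total

⊎-<-isTotalOrder≡ : {R : Rel A} {S : Rel B} →
                    IsTotalOrder _≡_ R → IsTotalOrder _≡_ S → IsTotalOrder _≡_ (R ⊎-< S)
⊎-<-isTotalOrder≡ R-total S-total =
  ≡-isTotalOrder Pointwise-≡⇒≡ id id (⊎-<-isTotalOrder R-total S-total)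

on-isTotalOrder : {R : Rel B} (f : A → B) → Injective _≡_ _≡_ f →
                  IsTotalOrder _≡_ R → IsTotalOrder _≡_ (R on f)
on-isTotalOrder f f-injective R-total = ≡-isTotalOrder f-injective id id (On.isTotalOrder f R-total)

total⇒decidable : {R : Rel A} → DecidableEquality A → IsTotalOrder _≡_ R → Decidable R
total⇒decidable _≟_ R-total = total∧dec⇒dec reflexive antisym total _≟_
  where open IsTotalOrder R-total

IsRealizer : Rel A → (Fin d → Rel A) → Set
IsRealizer R Ls = (∀ i → IsTotalOrder _≡_ (Ls i)) ×
                  (∀ i x y → R x y → Ls i x y) ×
                  (∀ x y → (∀ i → Ls i x y) → R x y)

isRealizer-resp : {R : Rel A} {Ls Ms : Fin d → Rel A} →
                  (∀ {i x y} → Ls i x y → Ms i x y) → (∀ {i x y} → Ms i x y → Ls i x y) →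
                  IsRealizer R Ls → IsRealizer R Ms
isRealizer-resp Ls⇒Ms Ms⇒Ls (Ls-total , Ls-ext , Ls-int) =
  (λ i → ≡-isTotalOrder id Ls⇒Ms Ms⇒Ls (Ls-total i)) ,
  (λ i x y p → Ls⇒Ms (Ls-ext i x y p)) ,
  (λ x y h → Ls-int x y (λ i → Ms⇒Ls (h i)))

realizer-restrict : {R : Rel A} {R′ : Rel B} {f : A → B} →
                    IsOrderMonomorphism _≡_ _≡_ R R′ f → Realizer R′ d → Realizer R d
realizer-restrict {f = f} f-embedding (Ls , Ls-total , Ls-ext , Ls-int) =
  (λ i → Ls i on f) ,
  (λ i → on-isTotalOrder f injective (Ls-total i)) ,
  (λ i x y p → Ls-ext i (f x) (f y) (mono p)) ,
  (λ x y h → cancel (Ls-int (f x) (f y) h))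
  where open IsOrderMonomorphism f-embedding

realizer₀⇒universal : {R : Rel A} → Realizer R 0 → ∀ x y → R x y
realizer₀⇒universal (_ , _ , _ , Ls-int) x y = Ls-int x y (λ ())

realizer⇒decidable : {R : Rel A} → DecidableEquality A → Realizer R d → Decidable R
realizer⇒decidable _≟_ (Ls , Ls-total , Ls-ext , Ls-int) x y =
  map′ (Ls-int x y) (λ p i → Ls-ext i x y p)
       (all? λ i → total⇒decidable _≟_ (Ls-total i) x y)

hasDim-between : {R : Rel A} → Dec (Realizer R m) → (∀ d → d < m → ¬ Realizer R d) →
              Realizer R (suc m) → ∃ λ d → HasDim R d × m ≤ d × d ≤ m + 1
hasDim-between {m = m} (yes R-realizer) none-below _ =
  m , (R-realizer , none-below) , ≤-refl , m≤m+n m 1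
hasDim-between {m = m} {R = R} (no ¬R-realizer) none-below R-realizer =
  suc m , (R-realizer , none-below′) , n≤1+n m , ≤-reflexive (+-comm 1 m)
  where
  none-below′ : ∀ d → d < suc m → ¬ Realizer R d
  none-below′ d d<1+m with m<1+n⇒m<n∨m≡n d<1+m
  ... | inj₁ d<m  = none-below d d<m
  ... | inj₂ refl = ¬R-realizer

Searchable : Set → Set₁
Searchable A = ∀ {P : U.Pred A 0ℓ} → U.Decidable P → Dec (∃ P)

search-Bool : Searchable Bool
search-Bool {P} P? = map′ [ (true ,_) , (false ,_) ]′ from (P? true ⊎-dec P? false)
  where
  from : ∃ P → P true ⊎ P false
  from (true , p)  = inj₁ p
  from (false , p) = inj₂ p

search-Vec : Searchable A → ∀ n → Searchable (Vec A n)
search-Vec search zero    P? = map′ ([] ,_) (λ { ([] , p) → p }) (P? [])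
search-Vec search (suc n) P? =
  map′ (λ (x , xs , p) → x ∷ xs , p) (λ { (x ∷ xs , p) → x , xs , p })
       (search λ x → search-Vec search n λ xs → P? (x ∷ xs))

-- Relations are searched as Boolean tables: vectors rather than functions, so that
-- exhaustive search needs no function extensionality.
Tables : ℕ → ℕ → Set
Tables d N = Vec (Vec (Vec Bool N) N) d

⟦_⟧ : Tables d N → Fin d → Rel (Fin N)
⟦ ts ⟧ i x y = T (lookup (lookup (lookup ts i) x) y)

tables : {Ls : Fin d → Rel (Fin N)} → (∀ i → Decidable (Ls i)) → Tables d N
tables Ls? = tabulate λ i → tabulate λ x → tabulate λ y → ⌊ Ls? i x y ⌋

lookup-tables : {Ls : Fin d → Rel (Fin N)} (Ls? : ∀ i → Decidable (Ls i)) →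
                ∀ i x y → lookup (lookup (lookup (tables Ls?) i) x) y ≡ ⌊ Ls? i x y ⌋
lookup-tables Ls? i x y = trans (cong (λ t → lookup (lookup t x) y) (lookup∘tabulate _ i))
                         (trans (cong (λ r → lookup r y) (lookup∘tabulate _ x))
                                (lookup∘tabulate _ y))

⟦tables⟧⁺ : {Ls : Fin d → Rel (Fin N)} (Ls? : ∀ i → Decidable (Ls i)) →
            ∀ {i x y} → Ls i x y → ⟦ tables Ls? ⟧ i x y
⟦tables⟧⁺ Ls? {i} {x} {y} p rewrite lookup-tables Ls? i x y = fromWitness p

⟦tables⟧⁻ : {Ls : Fin d → Rel (Fin N)} (Ls? : ∀ i → Decidable (Ls i)) →
            ∀ {i x y} → ⟦ tables Ls? ⟧ i x y → Ls i x y
⟦tables⟧⁻ Ls? {i} {x} {y} p rewrite lookup-tables Ls? i x y = toWitness p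

isTotalOrder? : {R : Rel (Fin N)} → Decidable R → Dec (IsTotalOrder _≡_ R)
isTotalOrder? {R = R} R? = map′ fromLaws toLaws
  (all? (λ x → R? x x) ×-dec
   all? (λ x → all? λ y → R? x y →-dec R? y x →-dec x ≟ᶠ y) ×-dec
   all? (λ x → all? λ y → all? λ z → R? x y →-dec R? y z →-dec R? x z) ×-dec
   all? (λ x → all? λ y → R? x y ⊎-dec R? y x))
  where
  Laws : Set
  Laws = (∀ x → R x x) × (∀ x y → R x y → R y x → x ≡ y) ×
         (∀ x y z → R x y → R y z → R x z) × (∀ x y → R x y ⊎ R y x)

  fromLaws : Laws → IsTotalOrder _≡_ R
  fromLaws (R-refl , R-antisym , R-trans , R-total) = record
    { isPartialOrder = record
      { isPreorder = record
        { isEquivalence = isEquivalence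
        ; reflexive     = λ { {x} refl → R-refl x }
        ; trans         = R-trans _ _ _
        }
      ; antisym = R-antisym _ _
      }
    ; total = R-total
    }

  toLaws : IsTotalOrder _≡_ R → Laws
  toLaws R-total = (λ _ → O.refl) , (λ _ _ → O.antisym) , (λ _ _ _ → O.trans) , O.total
    where module O = IsTotalOrder R-total

isRealizer? : {R : Rel (Fin N)} {Ls : Fin d → Rel (Fin N)} →
              Decidable R → (∀ i → Decidable (Ls i)) → Dec (IsRealizer R Ls)
isRealizer? R? Ls? =
  all? (λ i → isTotalOrder? (Ls? i)) ×-dec
  all? (λ i → all? λ x → all? λ y → R? x y →-dec Ls? i x y) ×-dec
  all? (λ x → all? λ y → all? (λ i → Ls? i x y) →-dec R? x y)

realizer?-Fin : {R : Rel (Fin N)} → Decidable R → ∀ d → Dec (Realizer R d)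
realizer?-Fin {N = N} {R = R} R? d =
  map′ (λ (ts , ts-realize) → ⟦ ts ⟧ , ts-realize) encode
       (search-Vec (search-Vec (search-Vec search-Bool N) N) d
                   (λ ts → isRealizer? R? (λ i x y → T? _)))
  where
  encode : Realizer R d → ∃ λ ts → IsRealizer R ⟦ ts ⟧
  encode (Ls , Ls-realize@(Ls-total , _)) =
    tables Ls? , isRealizer-resp (⟦tables⟧⁺ Ls?) (⟦tables⟧⁻ Ls?) Ls-realize
    where
    Ls? : ∀ i → Decidable (Ls i)
    Ls? i = total⇒decidable _≟ᶠ_ (Ls-total i)

realizer? : {R : Rel A} → Fin N ↔ A → Decidable R → ∀ d → Dec (Realizer R d)
realizer? {R = R} e R? d =
  map′ (realizer-restrict from-embedding) (realizer-restrict to-embedding)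
       (realizer?-Fin (λ x y → R? (to x) (to y)) d)
  where
  open Inverse e
  to-embedding : IsOrderMonomorphism _≡_ _≡_ (R on to) R to
  to-embedding = record
    { isOrderHomomorphism = record { cong = cong to ; mono = id }
    ; injective           = Injection.injective (↔⇒↣ e)
    ; cancel              = id
    }
  from-embedding : IsOrderMonomorphism _≡_ _≡_ R (R on to) from
  from-embedding = record
    { isOrderHomomorphism = record
      { cong = cong from
      ; mono = subst₂ R (sym (strictlyInverseˡ _)) (sym (strictlyInverseˡ _))
      }
    ; injective = Injection.injective (↔⇒↣ (↔-sym e))
    ; cancel    = subst₂ R (strictlyInverseˡ _) (strictlyInverseˡ _)
    }

module _ {n k : ℕ} {D : U.Pred (Fin n) 0ℓ} (D? : U.Decidable D) where

  splicePosition : Fin n ⊎ Fin k → (Fin n ⊎ Fin k) ⊎ Fin n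
  splicePosition (inj₁ x) with D? x
  ... | yes _ = inj₁ (inj₁ x)
  ... | no _  = inj₂ x
  splicePosition (inj₂ c) = inj₁ (inj₂ c)

  splicePosition-injective : Injective _≡_ _≡_ splicePosition
  splicePosition-injective {x} {y} eq = begin
    x                                  ≡⟨ sym (forget∘splicePosition x) ⟩
    [ id , inj₁ ]′ (splicePosition x)  ≡⟨ cong [ id , inj₁ ]′ eq ⟩
    [ id , inj₁ ]′ (splicePosition y)  ≡⟨ forget∘splicePosition y ⟩
    y                                  ∎
    where
    open ≡-Reasoning
    forget∘splicePosition : ∀ x → [ id , inj₁ ]′ (splicePosition x) ≡ x
    forget∘splicePosition (inj₁ x) with D? x
    ... | yes _ = refl
    ... | no _  = refl
    forget∘splicePosition (inj₂ c) = refl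

  -- D ordered by T, then the chain ordered by C, then the rest of Fin n ordered by T.
  Splice : Rel (Fin n) → Rel (Fin k) → Rel (Fin n ⊎ Fin k)
  Splice T C = ((T ⊎-< C) ⊎-< T) on splicePosition

  module _ {T : Rel (Fin n)} {C : Rel (Fin k)} where

    splice-isTotalOrder : IsTotalOrder _≡_ T → IsTotalOrder _≡_ C → IsTotalOrder _≡_ (Splice T C)
    splice-isTotalOrder T-total C-total = on-isTotalOrder splicePosition splicePosition-injective
      (⊎-<-isTotalOrder≡ (⊎-<-isTotalOrder≡ T-total C-total) T-total)

    splice-₁∼₁⁺ : ∀ {x y} → T x y → (D y → D x) → Splice T C (inj₁ x) (inj₁ y)
    splice-₁∼₁⁺ {x} {y} p D-down with D? x | D? y
    ... | yes _  | yes _ = ₁∼₁ (₁∼₁ p)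
    ... | yes _  | no _  = ₁∼₂
    ... | no ¬dx | yes dy = contradiction (D-down dy) ¬dx
    ... | no _   | no _  = ₂∼₂ p

    splice-₁∼₁⁻ : Total T → (∀ {x y} → T x y → D y → D x) →
                  ∀ {x y} → Splice T C (inj₁ x) (inj₁ y) → T x y
    splice-₁∼₁⁻ T-total D-down {x} {y} p with D? x | D? y | p
    ... | yes _  | yes _  | ₁∼₁ (₁∼₁ q) = q
    ... | no _   | no _   | ₂∼₂ q = q
    ... | yes dx | no ¬dy | ₁∼₂ with T-total x y
    ...   | inj₁ q = q
    ...   | inj₂ q = contradiction (D-down q dx) ¬dy

    splice-₁∼₂⁺ : ∀ {x c} → D x → Splice T C (inj₁ x) (inj₂ c)
    splice-₁∼₂⁺ {x} dx with D? x
    ... | yes _  = ₁∼₁ ₁∼₂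
    ... | no ¬dx = contradiction dx ¬dx

    splice-₁∼₂⁻ : ∀ {x c} → Splice T C (inj₁ x) (inj₂ c) → D x
    splice-₁∼₂⁻ {x} p with D? x | p
    ... | yes dx | _ = dx

    splice-₂∼₁⁺ : ∀ {c y} → ¬ D y → Splice T C (inj₂ c) (inj₁ y)
    splice-₂∼₁⁺ {y = y} ¬dy with D? y
    ... | yes dy = contradiction dy ¬dy
    ... | no _   = ₁∼₂

    splice-₂∼₁⁻ : ∀ {c y} → Splice T C (inj₂ c) (inj₁ y) → ¬ D y
    splice-₂∼₁⁻ {y = y} p with D? y | p
    ... | no ¬dy | _       = ¬dy
    ... | yes _  | ₁∼₁ ()

    splice-₂∼₂⁺ : ∀ {c c′} → C c c′ → Splice T C (inj₂ c) (inj₂ c′)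
    splice-₂∼₂⁺ p = ₁∼₁ (₂∼₂ p)

    splice-₂∼₂⁻ : ∀ {c c′} → Splice T C (inj₂ c) (inj₂ c′) → C c c′
    splice-₂∼₂⁻ (₁∼₁ (₂∼₂ p)) = p

record IsCut {n : ℕ} (L : Rel (Fin n)) (a b : Fin n) (D : U.Pred (Fin n) 0ℓ) : Set where
  field
    down-closed : ∀ {x y} → L x y → D y → D x
    contains-↓a : ∀ {x} → L x a → D x
    avoids-↑b   : ∀ {y} → L b y → ¬ D y

module _ {n k : ℕ} {L : Rel (Fin n)} {C : Rel (Fin k)} {a b : Fin n} where

  adjunctSum? : Decidable L → Decidable C → Decidable (AdjunctSum L C a b)
  adjunctSum? L? C? (inj₁ x) (inj₁ y) = L? x y
  adjunctSum? L? C? (inj₁ x) (inj₂ c) = L? x a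
  adjunctSum? L? C? (inj₂ c) (inj₁ y) = L? b y
  adjunctSum? L? C? (inj₂ c) (inj₂ c′) = C? c c′

  adjunctSum-restrict : Realizer (AdjunctSum L C a b) d → Realizer L d
  adjunctSum-restrict = realizer-restrict record
    { isOrderHomomorphism = record { cong = cong inj₁ ; mono = id }
    ; injective           = inj₁-injective
    ; cancel              = id
    }

  splice-extends : {D : U.Pred (Fin n) 0ℓ} (D? : U.Decidable D) {T : Rel (Fin n)} →
                   IsCut L a b D → (∀ x y → L x y → T x y) →
                   ∀ x y → AdjunctSum L C a b x y → Splice D? T C x y
  splice-extends D? cut T-ext (inj₁ x) (inj₁ y) p =
    splice-₁∼₁⁺ D? (T-ext x y p) (IsCut.down-closed cut p)
  splice-extends D? cut T-ext (inj₁ x) (inj₂ c) p = splice-₁∼₂⁺ D? (IsCut.contains-↓a cut p)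
  splice-extends D? cut T-ext (inj₂ c) (inj₁ y) p = splice-₂∼₁⁺ D? (IsCut.avoids-↑b cut p)
  splice-extends D? cut T-ext (inj₂ c) (inj₂ c′) p = splice-₂∼₂⁺ D? p

  module _ (L-partialOrder : IsPartialOrder _≡_ L) (C-total : IsTotalOrder _≡_ C)
           (a<b : Strict L a b) where

    private
      module L = IsPartialOrder L-partialOrder
      a≤b : L a b
      a≤b = proj₁ a<b
      a≢b : ¬ a ≡ b
      a≢b = proj₂ a<b

    ↓a-isCut : {T : Rel (Fin n)} → IsPartialOrder _≡_ T → (∀ x y → L x y → T x y) →
               IsCut L a b (λ x → T x a)
    ↓a-isCut T-partialOrder T-ext = record
      { down-closed = λ p q → T.trans (T-ext _ _ p) q
      ; contains-↓a = T-ext _ _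
      ; avoids-↑b   = λ p q → a≢b (T.antisym (T-ext _ _ a≤b) (T.trans (T-ext _ _ p) q))
      }
      where module T = IsPartialOrder T-partialOrder

    ∁↑b-isCut : IsCut L a b (λ x → ¬ L b x)
    ∁↑b-isCut = record
      { down-closed = λ p b≰y b≤x → b≰y (L.trans b≤x p)
      ; contains-↓a = λ p b≤x → a≢b (L.antisym a≤b (L.trans b≤x p))
      ; avoids-↑b   = λ p b≰y → b≰y p
      }

    adjunctSum-realizer : Realizer L m → Realizer (AdjunctSum L C a b) (suc m)
    adjunctSum-realizer {zero} L-realizer =
      contradiction (L.antisym a≤b (realizer₀⇒universal L-realizer b a)) a≢b
    adjunctSum-realizer {suc m} L-realizer@(Ls , Ls-total , Ls-ext , Ls-int) =
      Ms , Ms-total , Ms-ext , Ms-int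
      where
      L? : Decidable L
      L? = realizer⇒decidable _≟ᶠ_ L-realizer

      ↓a? : ∀ i → U.Decidable (λ x → Ls i x a)
      ↓a? i x = total⇒decidable _≟ᶠ_ (Ls-total i) x a

      ∁↑b? : U.Decidable (λ x → ¬ L b x)
      ∁↑b? x = ¬? (L? b x)

      Ms : Fin (suc (suc m)) → Rel (Fin n ⊎ Fin k)
      Ms zero    = Splice ∁↑b? (Ls zero) C
      Ms (suc i) = Splice (↓a? i) (Ls i) C

      Ms-total : ∀ j → IsTotalOrder _≡_ (Ms j)
      Ms-total zero    = splice-isTotalOrder ∁↑b? (Ls-total zero) C-total
      Ms-total (suc i) = splice-isTotalOrder (↓a? i) (Ls-total i) C-total

      Ms-ext : ∀ j x y → AdjunctSum L C a b x y → Ms j x y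
      Ms-ext zero    = splice-extends ∁↑b? ∁↑b-isCut (Ls-ext zero)
      Ms-ext (suc i) = splice-extends (↓a? i)
        (↓a-isCut (IsTotalOrder.isPartialOrder (Ls-total i)) (Ls-ext i)) (Ls-ext i)

      Ms-int : ∀ x y → (∀ j → Ms j x y) → AdjunctSum L C a b x y
      Ms-int (inj₁ x) (inj₁ y) h = Ls-int x y λ i →
        splice-₁∼₁⁻ (↓a? i) (IsTotalOrder.total (Ls-total i)) (IsTotalOrder.trans (Ls-total i))
                    (h (suc i))
      Ms-int (inj₁ x) (inj₂ c) h = Ls-int x a λ i → splice-₁∼₂⁻ (↓a? i) (h (suc i))
      Ms-int (inj₂ c) (inj₁ y) h = decidable-stable (L? b y) (splice-₂∼₁⁻ ∁↑b? (h zero))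
      Ms-int (inj₂ c) (inj₂ c′) h = splice-₂∼₂⁻ ∁↑b? (h zero)

mainTheorem8 : (n k m : ℕ) (_≤L_ : Rel (Fin n)) (_≤C_ : Rel (Fin k)) (a b : Fin n) →
    IsFinLattice _≤L_ → 3 ≤ n →
    IsTotalOrder _≡_ _≤C_ → 1 ≤ k →
    Strict _≤L_ a b → ¬ Covers _≤L_ a b →
    HasDim _≤L_ m →
    ∃ λ d → HasDim (AdjunctSum _≤L_ _≤C_ a b) d × m ≤ d × d ≤ m + 1
mainTheorem8 n k m _≤L_ _≤C_ a b L-lattice _ C-total _ a<b _ (L-realizer , L-minimal) =
  hasDim-between (realizer? +↔⊎ (adjunctSum? L? C?) m)
                 (λ d d<m → L-minimal d d<m ∘ adjunctSum-restrict)
                 (adjunctSum-realizer (IsFinLattice.isPartialOrder L-lattice) C-total a<b L-realizer)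
  where
  L? : Decidable _≤L_
  L? = realizer⇒decidable _≟ᶠ_ L-realizer
  C? : Decidable _≤C_
  C? = total⇒decidable _≟ᶠ_ C-total
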